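{- For all integers $h\ge 1$ and $k\ge 1$, there is a deterministic thrifty $k$-way branching program with exactly $(k+1)^h$ states that solves $FT^h_2(k)$.
   Context: For $h\ge1$, $T^h$ is the balanced binary tree with $h$ levels (so $T^1$ is a single node and $T^2$ has 3 nodes), with nodes numbered heap-style: the root is $1$ and the children of node $i$ are $2i$ and $2i+1$. Write $[k]=\{1,\dots,k\}$. An input $I$ consists of, for each internal node $i$, a function $f_i^I:[k]\times[k]\to[k]$ given as the $k^2$ input variables $f_i(a,b)\in[k]$ ($a,b\in[k]$), and for each leaf $i$ an input variable $l_i\in[k]$. Node values are $v_i^I=l_i^I$ for a leaf $i$ and $v_i^I=f_i^I(v_{2i}^I,v_{2i+1}^I)$ for an internal node $i$. $FT^h_2(k)$ is the function mapping $I$ to $v_1^I$. A deterministic $k$-way branching program computing $g:[k]^m\to R$ is a directed rooted multigraph whose nodes are called states; there is a unique start state; every non-output state is labeled by an input variable (one of the $m$ variables) and has exactly $k$ out-edges labeled $1,\dots,k$; there are $|R|$ sink output states labeled by the elements of $R$. On an input, from a state labeled by variable $X$ one follows the edge labeled by the value of $X$; the computation path from the start state must end at the output state labeled by the correct function value. The size is the number of states. A deterministic branching program solving $FT^h_2(k)$ is thrifty if for every input $I$, every state on the computation path of $I$ that queries a variable $f_i(a,b)$ (for an internal node $i$) satisfies $a=v_{2i}^I$ and $b=v_{2i+1}^I$. -}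

module Defs where

open import Data.Nat using (ℕ; zero; suc; _+_; _*_; _^_)
open import Data.Fin using (Fin)
open import Data.Sum using (_⊎_; inj₁; inj₂)
open import Data.Product using (_×_; _,_; Σ; ∃)
open import Data.Unit using (⊤; tt)
open import Relation.Binary.PropositionalEquality using (_≡_)

-- We index by n with h = suc n (so h ≥ 1).
-- The nodes of T^h are encoded structurally: a node of T^(n+2) is the
-- root (heap number 1), a node of the left subtree (heap 2i ↦ …) or a
-- node of the right subtree.
--
-- Var k n : the input variables of FT^(suc n)_2(k):
--   leaf            : the variable l_i of the (only) node of T^1
--   root a b        : the variable f_1(a,b) of the root of T^(n+2)
--   left x / right x: variable x of the subtree rooted at node 2 / 3

data Var (k : ℕ) : ℕ → Set where
  leaf  : Var k zero
  root  : {n : ℕ} → Fin k → Fin k → Var k (suc n)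
  left  : {n : ℕ} → Var k n → Var k (suc n)
  right : {n : ℕ} → Var k n → Var k (suc n)

Input : ℕ → ℕ → Set
Input k n = Var k n → Fin k

leftIn : {k n : ℕ} → Input k (suc n) → Input k n
leftIn I x = I (left x)

rightIn : {k n : ℕ} → Input k (suc n) → Input k n
rightIn I x = I (right x)

FT : (k n : ℕ) → Input k n → Fin k
FT k zero    I = I leaf
FT k (suc n) I = I (root (FT k n (leftIn I)) (FT k n (rightIn I)))

ThriftyQuery : {k n : ℕ} → Input k n → Var k n → Set
ThriftyQuery {k} {zero}  I leaf      = ⊤
ThriftyQuery {k} {suc n} I (root a b) =
  (a ≡ FT k n (leftIn I)) × (b ≡ FT k n (rightIn I))
ThriftyQuery {k} {suc n} I (left x)  = ThriftyQuery (leftIn I) x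
ThriftyQuery {k} {suc n} I (right x) = ThriftyQuery (rightIn I) x

record BP (V : Set) (k : ℕ) (R : Set) (s : ℕ) : Set where
  field
    start : Fin s
    node  : Fin s → (V × (Fin k → Fin s)) ⊎ R
    outputs-onto : (r : R) → ∃ λ q → node q ≡ inj₂ r
    outputs-unique : (q q′ : Fin s) (r : R) →
                     node q ≡ inj₂ r → node q′ ≡ inj₂ r → q ≡ q′

module _ {V : Set} {k : ℕ} {R : Set} {s : ℕ} (P : BP V k R s)
         (I : V → Fin k) where
  open BP P

  -- Computation path from state q (under input I) ending at the output
  -- state labelled r.  Since the program is deterministic, a derivation
  -- is exactly the (finite) computation path.
  data Run : Fin s → R → Set where
    halt : {q : Fin s} {r : R} → node q ≡ inj₂ r → Run q r
    step : {q : Fin s} {x : V} {e : Fin k → Fin s} {r : R} →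
           node q ≡ inj₁ (x , e) → Run (e (I x)) r → Run q r

  AllQueries : (V → Set) → {q : Fin s} {r : R} → Run q r → Set
  AllQueries Q (halt _)              = ⊤
  AllQueries Q (step {x = x} _ rest) = Q x × AllQueries Q rest

ThriftySolves : (k n s : ℕ) → BP (Var k n) k (Fin k) s → Set
ThriftySolves k n s P =
  (I : Input k n) →
  Σ (Run P I (BP.start P) (FT k n I)) λ path →
    AllQueries P I (ThriftyQuery I) path

module Submission where

-- The program for a tree of height n + 1 over values [K] is built
-- recursively.  For height 1 it is a single query of the leaf.  For
-- height n + 2 its query states are: a copy of the program for the left
-- subtree; K copies of the program for the right subtree, one for each
-- possible value a of the left subtree; and K·K states querying the root
-- function f_1(a,b), one for each pair (a,b) of subtree values.  Each
-- subprogram, instead of halting with a value, jumps to the next phase.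
-- Together with K output states this gives c + K states where
-- c(n + 1) + K = (K + 1)(c(n) + K), i.e. (K + 1)^(n+1) states.

open import Defs
open import Data.Nat using (ℕ; zero; suc; _+_; _*_; _^_)
open import Data.Fin using (Fin)
open import Data.Fin.Properties using (+↔⊎; *↔×)
open import Data.Product using (Σ; _×_; _,_)
open import Data.Product.Function.NonDependent.Propositional using (_×-↔_)
open import Data.Sum using (_⊎_; inj₁; inj₂)
open import Data.Sum.Function.Propositional using (_⊎-↔_)
open import Data.Unit using (tt)
open import Data.Nat.Solver using (module +-*-Solver)
open import Function.Bundles using (_↔_; Inverse)
open import Function.Properties.Inverse using (↔-refl; ↔-sym; ↔-trans)
open import Relation.Binary.Construct.Closure.ReflexiveTransitive using (Star; ε; _◅_; _◅◅_; gmap)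
open import Relation.Binary.PropositionalEquality using (_≡_; refl; sym; trans; cong; subst)

record Program (V : Set) (k : ℕ) (R : Set) (Q : Set) : Set where
  field
    start : Q ⊎ R
    query : Q → V
    next  : Q → Fin k → Q ⊎ R

module _ {V R Q : Set} {k : ℕ} (P : Program V k R Q) (I : V → Fin k) (G : V → Set) where
  open Program P

  data Step : Q ⊎ R → Q ⊎ R → Set where
    ask : {q : Q} → G (query q) → Step (inj₁ q) (next q (I (query q)))

  Computation : Q ⊎ R → Q ⊎ R → Set
  Computation = Star Step

module Numbering {V R Q : Set} {k s : ℕ} (P : Program V k R Q) (numbering : (Q ⊎ R) ↔ Fin s) where
  open Program P
  open Inverse numbering using (to; from; strictlyInverseˡ; strictlyInverseʳ)

  label : Q ⊎ R → (V × (Fin k → Fin s)) ⊎ R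
  label (inj₁ q) = inj₁ (query q , λ c → to (next q c))
  label (inj₂ r) = inj₂ r

  label-to : (x : Q ⊎ R) → label (from (to x)) ≡ label x
  label-to x = cong label (strictlyInverseʳ x)

  output-label : (x : Q ⊎ R) (r : R) → label x ≡ inj₂ r → x ≡ inj₂ r
  output-label (inj₂ r) .r refl = refl

  output-state : (i : Fin s) (r : R) → label (from i) ≡ inj₂ r → i ≡ to (inj₂ r)
  output-state i r e = trans (sym (strictlyInverseˡ i)) (cong to (output-label (from i) r e))

  program : BP V k R s
  program = record
    { start          = to start
    ; node           = λ i → label (from i)
    ; outputs-onto   = λ r → to (inj₂ r) , label-to (inj₂ r)
    ; outputs-unique = λ i i′ r e e′ → trans (output-state i r e) (sym (output-state i′ r e′))
    }

  computation⇒run : (I : V → Fin k) (G : V → Set) {x : Q ⊎ R} {r : R} →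
                    Computation P I G x (inj₂ r) →
                    Σ (Run program I (to x) r) (AllQueries program I G)
  computation⇒run I G {r = r} ε = halt (label-to (inj₂ r)) , tt
  computation⇒run I G (ask {q} g ◅ rest) with computation⇒run I G rest
  ... | run , queries = step (label-to (inj₁ q)) run , g , queries

module Tree (K : ℕ) where

  -- Query states of the program for trees of height n + 1: the left
  -- subtree phase, the right subtree phase (remembering the left value)
  -- and the root phase (remembering both subtree values).
  State : ℕ → Set
  State zero    = Fin 1
  State (suc n) = State n ⊎ ((Fin K × State n) ⊎ (Fin K × Fin K))

  entry : (n : ℕ) → State n
  entry zero    = Fin.zero
  entry (suc n) = inj₁ (entry n)

  intoLeft : (n : ℕ) → State n ⊎ Fin K → State (suc n) ⊎ Fin K
  intoLeft n (inj₁ q) = inj₁ (inj₁ q)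
  intoLeft n (inj₂ a) = inj₁ (inj₂ (inj₁ (a , entry n)))

  intoRight : (n : ℕ) → Fin K → State n ⊎ Fin K → State (suc n) ⊎ Fin K
  intoRight n a (inj₁ q) = inj₁ (inj₂ (inj₁ (a , q)))
  intoRight n a (inj₂ b) = inj₁ (inj₂ (inj₂ (a , b)))

  queried : (n : ℕ) → State n → Var K n
  queried zero    _                      = leaf
  queried (suc n) (inj₁ q)               = left (queried n q)
  queried (suc n) (inj₂ (inj₁ (_ , q)))  = right (queried n q)
  queried (suc n) (inj₂ (inj₂ (a , b)))  = root a b

  next : (n : ℕ) → State n → Fin K → State n ⊎ Fin K
  next zero    _                      c = inj₂ c
  next (suc n) (inj₁ q)               c = intoLeft n (next n q c)
  next (suc n) (inj₂ (inj₁ (a , q)))  c = intoRight n a (next n q c)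
  next (suc n) (inj₂ (inj₂ _))        c = inj₂ c

  tree : (n : ℕ) → Program (Var K n) K (Fin K) (State n)
  tree n = record { start = inj₁ (entry n) ; query = queried n ; next = next n }

  Thrifty : (n : ℕ) (I : Input K n) → State n ⊎ Fin K → State n ⊎ Fin K → Set
  Thrifty n I = Computation (tree n) I (ThriftyQuery I)

  inLeftPhase : {n : ℕ} {I : Input K (suc n)} {x y : State n ⊎ Fin K} →
                Thrifty n (leftIn I) x y → Thrifty (suc n) I (intoLeft n x) (intoLeft n y)
  inLeftPhase = gmap _ (λ { (ask t) → ask t })

  inRightPhase : {n : ℕ} {I : Input K (suc n)} (a : Fin K) {x y : State n ⊎ Fin K} →
                 Thrifty n (rightIn I) x y → Thrifty (suc n) I (intoRight n a x) (intoRight n a y)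
  inRightPhase a = gmap _ (λ { (ask t) → ask t })

  -- Correctness: from its entry, the program reaches the output FT(I)
  -- making thrifty queries only.  The root is queried at the pair of
  -- subtree values, which is exactly the thrifty condition.
  evaluates : (n : ℕ) (I : Input K n) → Thrifty n I (inj₁ (entry n)) (inj₂ (FT K n I))
  evaluates zero    I = ask tt ◅ ε
  evaluates (suc n) I =
    inLeftPhase (evaluates n (leftIn I)) ◅◅
    inRightPhase (FT K n (leftIn I)) (evaluates n (rightIn I)) ◅◅
    ask (refl , refl) ◅ ε

  queryCount : ℕ → ℕ
  queryCount zero    = 1
  queryCount (suc n) = queryCount n + (K * queryCount n + K * K)

  State↔ : (n : ℕ) → State n ↔ Fin (queryCount n)
  State↔ zero    = ↔-refl
  State↔ (suc n) =
    ↔-trans (State↔ n ⊎-↔ ((↔-refl ×-↔ State↔ n) ⊎-↔ ↔-refl))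
            (↔-sym (↔-trans +↔⊎ (↔-refl ⊎-↔ ↔-trans +↔⊎ (*↔× ⊎-↔ *↔×))))

  open +-*-Solver

  stateCount : (n : ℕ) → queryCount n + K ≡ (K + 1) ^ suc n
  stateCount zero    = solve 1 (λ K → con 1 :+ K := (K :+ con 1) :* con 1) refl K
  stateCount (suc n) = trans (recurrence (queryCount n) K) (cong ((K + 1) *_) (stateCount n))
    where
    recurrence : (c K : ℕ) → c + (K * c + K * K) + K ≡ (K + 1) * (c + K)
    recurrence = solve 2 (λ c K → c :+ (K :* c :+ K :* K) :+ K := (K :+ con 1) :* (c :+ K)) refl

  numbering : (n : ℕ) → (State n ⊎ Fin K) ↔ Fin ((K + 1) ^ suc n)
  numbering n = ↔-trans (State↔ n ⊎-↔ ↔-refl)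
                  (↔-trans (↔-sym +↔⊎) (subst (λ m → Fin (queryCount n + K) ↔ Fin m) (stateCount n) ↔-refl))

mainTheorem1 : (h k : ℕ) → Σ (BP (Var (suc k) h) (suc k) (Fin (suc k)) ((suc k + 1) ^ suc h))
                 (ThriftySolves (suc k) h ((suc k + 1) ^ suc h))
mainTheorem1 h k = program , λ I → computation⇒run I (ThriftyQuery I) (evaluates h I)
  where
  open Tree (suc k)
  open Numbering (tree h) (numbering h)
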